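{- The synchronization rule SYNC, which from the premise sequent $\xi \diamond \Gamma \vdash \mu X. \Psi',\, \Delta$ derives the conclusion $\xi \diamond \Gamma \vdash \mu X. \Psi,\, \Delta$ under the side condition $L(gr(\Psi')) \subseteq L(gr(\Psi))$, is sound: if the premise is a valid sequent, so is the conclusion (hence only valid sequents are derivable).
   Context: Trace formulas are generated by $\Phi ::= p \mid R \mid \Phi \land \Phi \mid \Phi \lor \Phi \mid \Phi \frown \Phi \mid X \mid \mu X.\Phi$ with the standard set-of-finite-traces semantics $[\![\cdot]\!]_{\mathbb{V}}$ under valuations $\mathbb{V}$ of recursion variables ($\frown$ is chop: $[\![\Phi_1\frown\Phi_2]\!]_{\mathbb{V}} = \{\sigma\cdot s\cdot\sigma' \mid \sigma\cdot s\in[\![\Phi_1]\!]_{\mathbb{V}},\ s\cdot\sigma'\in[\![\Phi_2]\!]_{\mathbb{V}}\}$; $\mu$ is least fixed point). A sequent $\xi \diamond \Gamma \vdash \Delta$ has $\Gamma,\Delta$ sets of trace formulas and $\xi$ a set of triples $(X|p, X')$ (recursion variables $X,X'$, predicate $p$); it is valid if for all valuations $\mathbb{V}$ with $[\![X\land p]\!]_{\mathbb{V}}\subseteq[\![X']\!]_{\mathbb{V}}$ for all $(X|p,X')\in\xi$, we have $[\![\bigwedge\Gamma]\!]_{\mathbb{V}} \subseteq [\![\bigvee\Delta]\!]_{\mathbb{V}}$. For a fixed relation $R$ and recursion variable $X$, primitive chop formulas are chop sequences of $R$ and $X$, and chop formulas $CF_{(R,X)}$ are finite disjunctions of primitive chop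 formulas; $\Psi,\Psi'\in CF_{(R,X)}$. For $\Psi=\bigvee_{i}\varphi_i$, $gr(\Psi)$ is the context-free grammar with non-terminal (and start symbol) $X$, terminal $R$, and productions $X\to grammatize(\varphi_i)$, where $grammatize(S_1\frown\cdots\frown S_n)=S_1\cdots S_n$; $L(\cdot)$ is its language. -}

module Defs where

open import Data.Nat using (ℕ)
open import Data.List using (List; []; _∷_; _++_; map)
open import Data.List.NonEmpty using (List⁺; _∷_; toList)
open import Data.List.Membership.Propositional using (_∈_)
open import Data.List.Relation.Unary.All using (All)
open import Data.List.Relation.Unary.Any using (Any)
open import Data.Product using (_×_; _,_)
open import Data.Sum using (_⊎_; inj₁; inj₂)
open import Relation.Binary.PropositionalEquality using (_≢_)

Var : Set
Var = ℕ

Trace : Set → Set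
Trace S = List S

infixr 6 _∧_
infixr 5 _∨_
infixr 7 _⌢_

data Form (S : Set) : Set₁ where
  pr  : (S → Set) → Form S
  rel : (S → S → Set) → Form S
  _∧_ : Form S → Form S → Form S
  _∨_ : Form S → Form S → Form S
  _⌢_ : Form S → Form S → Form S
  var : Var → Form S
  μ   : Var → Form S → Form S

-- Syntactic environments recording the enclosing μ-binders:
-- in (bind X Φ ρ), X denotes the least fixed point ⟦μ X. Φ⟧ under ρ.
data Env (S : Set) : Set₁ where
  []   : Env S
  bind : Var → Form S → Env S → Env S

Valuation : Set → Set₁
Valuation S = Var → Trace S → Set

-- Satisfaction.  Being an inductive family, it is the least relation
-- closed under the clauses; in particular the μ clause yields the
-- least fixed point  ⟦μX.Φ⟧ = lfp (P ↦ ⟦Φ⟧[X ↦ P]).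
data Sat {S : Set} (V : Valuation S) : Env S → Form S → Trace S → Set₁ where
  sat-p   : ∀ {ρ p s} → p s → Sat V ρ (pr p) (s ∷ [])
  sat-R   : ∀ {ρ R s s'} → R s s' → Sat V ρ (rel R) (s ∷ s' ∷ [])
  sat-∧   : ∀ {ρ Φ₁ Φ₂ σ} → Sat V ρ Φ₁ σ → Sat V ρ Φ₂ σ → Sat V ρ (Φ₁ ∧ Φ₂) σ
  sat-∨ˡ  : ∀ {ρ Φ₁ Φ₂ σ} → Sat V ρ Φ₁ σ → Sat V ρ (Φ₁ ∨ Φ₂) σ
  sat-∨ʳ  : ∀ {ρ Φ₁ Φ₂ σ} → Sat V ρ Φ₂ σ → Sat V ρ (Φ₁ ∨ Φ₂) σ
  sat-⌢   : ∀ {ρ Φ₁ Φ₂ σ s σ'} →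
            Sat V ρ Φ₁ (σ ++ s ∷ []) → Sat V ρ Φ₂ (s ∷ σ') →
            Sat V ρ (Φ₁ ⌢ Φ₂) (σ ++ s ∷ σ')
  sat-μ   : ∀ {ρ X Φ σ} → Sat V (bind X Φ ρ) Φ σ → Sat V ρ (μ X Φ) σ
  sat-here  : ∀ {ρ X Φ σ} → Sat V (bind X Φ ρ) Φ σ → Sat V (bind X Φ ρ) (var X) σ
  sat-there : ∀ {ρ X Y Φ σ} → X ≢ Y → Sat V ρ (var X) σ → Sat V (bind Y Φ ρ) (var X) σ
  sat-free  : ∀ {X σ} → V X σ → Sat V [] (var X) σ

⟦_⟧ : {S : Set} → Form S → Valuation S → Trace S → Set₁
⟦ Φ ⟧ V σ = Sat V [] Φ σ

Side : Set → Set₁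
Side S = Var × (S → Set) × Var

Valid : {S : Set} → List (Side S) → List (Form S) → List (Form S) → Set₁
Valid {S} ξ Γ Δ =
  (V : Valuation S) →
  (∀ {X p X'} → (X , p , X') ∈ ξ →
     ∀ σ → ⟦ var X ∧ pr p ⟧ V σ → ⟦ var X' ⟧ V σ) →
  ∀ σ → All (λ φ → ⟦ φ ⟧ V σ) Γ → Any (λ φ → ⟦ φ ⟧ V σ) Δ

data ChopSym : Set where
  `R `X : ChopSym

Prim : Set
Prim = List⁺ ChopSym

CF : Set
CF = List⁺ Prim

symForm : {S : Set} → (S → S → Set) → Var → ChopSym → Form S
symForm R X `R = rel R
symForm R X `X = var X

primForm′ : {S : Set} → (S → S → Set) → Var → ChopSym → List ChopSym → Form S
primForm′ R X c []       = symForm R X c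
primForm′ R X c (d ∷ cs) = symForm R X c ⌢ primForm′ R X d cs

primForm : {S : Set} → (S → S → Set) → Var → Prim → Form S
primForm R X (c ∷ cs) = primForm′ R X c cs

cfForm′ : {S : Set} → (S → S → Set) → Var → Prim → List Prim → Form S
cfForm′ R X φ []       = primForm R X φ
cfForm′ R X φ (ψ ∷ ψs) = primForm R X φ ∨ cfForm′ R X ψ ψs

cfForm : {S : Set} → (S → S → Set) → Var → CF → Form S
cfForm R X (φ ∷ φs) = cfForm′ R X φ φs

record CFG : Set₁ where
  field
    NT    : Set
    T     : Set
    start : NT
    prods : List (NT × List (NT ⊎ T))

module _ (G : CFG) where
  open CFG G
  mutual
    data Derives : NT → List T → Set where
      derive : ∀ {n rhs w} → (n , rhs) ∈ prods → DerivesSeq rhs w → Derives n w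

    data DerivesSeq : List (NT ⊎ T) → List T → Set where
      seq-[] : DerivesSeq [] []
      seq-t  : ∀ {t rest w} → DerivesSeq rest w → DerivesSeq (inj₂ t ∷ rest) (t ∷ w)
      seq-n  : ∀ {n rest w₁ w₂} → Derives n w₁ → DerivesSeq rest w₂ →
               DerivesSeq (inj₁ n ∷ rest) (w₁ ++ w₂)

L : (G : CFG) → List (CFG.T G) → Set
L G w = Derives G (CFG.start G) w

data NonTermX : Set where
  ntX : NonTermX

data TermR : Set where
  tR : TermR

grSym : ChopSym → NonTermX ⊎ TermR
grSym `R = inj₂ tR
grSym `X = inj₁ ntX

grammatize : Prim → List (NonTermX ⊎ TermR)
grammatize φ = map grSym (toList φ)

gr : CF → CFG
gr Ψ = record
  { NT    = NonTermX
  ; T     = TermR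
  ; start = ntX
  ; prods = map (λ φ → (ntX , grammatize φ)) (toList Ψ)
  }

_⊆L_ : CF → CF → Set
Ψ' ⊆L Ψ = ∀ (w : List TermR) → L (gr Ψ') w → L (gr Ψ) w

module Submission where

-- A trace satisfies μX.Ψ for a chop formula Ψ ∈ CF_(R,X) exactly when it is
-- an R-path whose length, written as a word Rⁿ, is derivable in gr(Ψ):
-- unfolding X corresponds to applying a production, and chopping two paths at
-- a shared state corresponds to concatenating their words.  Hence ⟦μX.Ψ'⟧ ⊆
-- ⟦μX.Ψ⟧ whenever L(gr Ψ') ⊆ L(gr Ψ).

open import Defs
open import Data.List using (List; []; _∷_; _++_)
open import Data.List.NonEmpty using (_∷_; toList)
open import Data.List.Properties using (++-identityʳ)
open import Data.List.Membership.Propositional using (_∈_)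
open import Data.List.Membership.Propositional.Properties using (∈-map⁺; ∈-map⁻)
open import Data.List.Relation.Binary.Subset.Propositional using (_⊆_)
open import Data.List.Relation.Unary.Any using (here; there)
open import Data.Product using (∃; ∃₂; _×_; _,_)
open import Relation.Binary.PropositionalEquality using (_≡_; refl; sym; subst)

data Path {S : Set} (R : S → S → Set) : Trace S → List TermR → Set where
  stop : ∀ {s} → Path R (s ∷ []) []
  step : ∀ {s s' σ w} → R s s' → Path R (s' ∷ σ) w → Path R (s ∷ s' ∷ σ) (tR ∷ w)

module _ {S : Set} {R : S → S → Set} where

  Path-++ : ∀ σ {s σ' w₁ w₂} → Path R (σ ++ s ∷ []) w₁ → Path R (s ∷ σ') w₂ →
            Path R (σ ++ s ∷ σ') (w₁ ++ w₂)
  Path-++ []          stop            p₂ = p₂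
  Path-++ (_ ∷ [])    (step r stop)   p₂ = step r p₂
  Path-++ (_ ∷ b ∷ σ) (step r p₁)     p₂ = step r (Path-++ (b ∷ σ) p₁ p₂)

  Path-split : ∀ w₁ w₂ {σ} → Path R σ (w₁ ++ w₂) →
               ∃₂ λ τ s → ∃ λ τ' →
                 σ ≡ τ ++ s ∷ τ' × Path R (τ ++ s ∷ []) w₁ × Path R (s ∷ τ') w₂
  Path-split []         _  stop       = [] , _ , [] , refl , stop , stop
  Path-split []         _  (step r p) = [] , _ , _ , refl , stop , step r p
  Path-split (tR ∷ w₁) w₂ (step r p) with Path-split w₁ w₂ p
  ... | []    , s , τ' , refl , p₁ , p₂ = _ ∷ []    , s , τ' , refl , step r p₁ , p₂
  ... | b ∷ τ , s , τ' , refl , p₁ , p₂ = _ ∷ b ∷ τ , s , τ' , refl , step r p₁ , p₂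

cfForm′-intro : ∀ {S} {R : S → S → Set} {X V ρ σ ψ} φ φs → ψ ∈ φ ∷ φs →
                Sat V ρ (primForm R X ψ) σ → Sat V ρ (cfForm′ R X φ φs) σ
cfForm′-intro φ []       (here refl) d = d
cfForm′-intro φ (χ ∷ χs) (here refl) d = sat-∨ˡ d
cfForm′-intro φ (χ ∷ χs) (there ψ∈) d = sat-∨ʳ (cfForm′-intro χ χs ψ∈ d)

rel⇒Path : ∀ {S} {R : S → S → Set} {V ρ σ} → Sat V ρ (rel R) σ → Path R σ (tR ∷ [])
rel⇒Path (sat-R r) = step r stop

production-gr : ∀ {Ψ ψ} → ψ ∈ toList Ψ → (ntX , grammatize ψ) ∈ CFG.prods (gr Ψ)
production-gr = ∈-map⁺ (λ φ → (ntX , grammatize φ))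

module Unfolding {S : Set} (R : S → S → Set) (X : Var) (V : Valuation S) (Ψ : CF) where

  LangPath : Trace S → Set
  LangPath σ = ∃ λ w → L (gr Ψ) w × Path R σ w

  private
    ρ : Env S
    ρ = bind X (cfForm R X Ψ) []

  mutual
    var⇒LangPath : ∀ {σ} → Sat V ρ (var X) σ → LangPath σ
    var⇒LangPath (sat-here d)         = cfForm′⇒LangPath _ _ (λ ψ∈ → ψ∈) d
    var⇒LangPath (sat-there X≢X _) with () ← X≢X refl

    cfForm′⇒LangPath : ∀ {σ} φ φs → φ ∷ φs ⊆ toList Ψ →
                       Sat V ρ (cfForm′ R X φ φs) σ → LangPath σ
    cfForm′⇒LangPath (c ∷ cs) [] ⊆Ψ d with primForm′⇒DerivesSeq c cs d
    ... | w , ds , p = w , derive (production-gr (⊆Ψ (here refl))) ds , p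
    cfForm′⇒LangPath (c ∷ cs) (_ ∷ _) ⊆Ψ (sat-∨ˡ d) with primForm′⇒DerivesSeq c cs d
    ... | w , ds , p = w , derive (production-gr (⊆Ψ (here refl))) ds , p
    cfForm′⇒LangPath _ (ψ ∷ ψs) ⊆Ψ (sat-∨ʳ d) = cfForm′⇒LangPath ψ ψs (λ ψ∈ → ⊆Ψ (there ψ∈)) d

    primForm′⇒DerivesSeq : ∀ {σ} c cs → Sat V ρ (primForm′ R X c cs) σ →
                           ∃ λ w → DerivesSeq (gr Ψ) (grammatize (c ∷ cs)) w × Path R σ w
    primForm′⇒DerivesSeq `R [] d = tR ∷ [] , seq-t seq-[] , rel⇒Path d
    primForm′⇒DerivesSeq {σ} `X [] d with var⇒LangPath d
    ... | w , D , p = w ++ [] , seq-n D seq-[] , subst (Path R σ) (sym (++-identityʳ w)) p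
    primForm′⇒DerivesSeq `R (e ∷ cs) (sat-⌢ {σ = τ} d₁ d₂) with primForm′⇒DerivesSeq e cs d₂
    ... | w , ds , p = tR ∷ w , seq-t ds , Path-++ τ (rel⇒Path d₁) p
    primForm′⇒DerivesSeq `X (e ∷ cs) (sat-⌢ {σ = τ} d₁ d₂)
      with var⇒LangPath d₁ | primForm′⇒DerivesSeq e cs d₂
    ... | w₁ , D , p₁ | w₂ , ds , p₂ = w₁ ++ w₂ , seq-n D ds , Path-++ τ p₁ p₂

  mutual
    LangPath⇒cfForm : ∀ {w σ} → L (gr Ψ) w → Path R σ w → Sat V ρ (cfForm R X Ψ) σ
    LangPath⇒cfForm (derive prod ds) p with ∈-map⁻ (λ φ → (ntX , grammatize φ)) prod
    ... | c ∷ cs , ψ∈ , refl = cfForm′-intro _ _ ψ∈ (DerivesSeq⇒primForm′ c cs ds p)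

    DerivesSeq⇒primForm′ : ∀ {w σ} c cs → DerivesSeq (gr Ψ) (grammatize (c ∷ cs)) w →
                           Path R σ w → Sat V ρ (primForm′ R X c cs) σ
    DerivesSeq⇒primForm′ `R [] (seq-t seq-[]) (step r stop) = sat-R r
    DerivesSeq⇒primForm′ {σ = σ} `X [] (seq-n {w₁ = w} D seq-[]) p =
      sat-here (LangPath⇒cfForm D (subst (Path R σ) (++-identityʳ w) p))
    DerivesSeq⇒primForm′ `R (e ∷ cs) (seq-t ds) (step r p) =
      sat-⌢ {σ = _ ∷ []} (sat-R r) (DerivesSeq⇒primForm′ e cs ds p)
    DerivesSeq⇒primForm′ `X (e ∷ cs) (seq-n {w₁ = w₁} {w₂ = w₂} D ds) p
      with Path-split w₁ w₂ p
    ... | _ , _ , _ , refl , p₁ , p₂ =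
      sat-⌢ (sat-here (LangPath⇒cfForm D p₁)) (DerivesSeq⇒primForm′ e cs ds p₂)

  μ⇒LangPath : ∀ {σ} → ⟦ μ X (cfForm R X Ψ) ⟧ V σ → LangPath σ
  μ⇒LangPath (sat-μ d) = cfForm′⇒LangPath _ _ (λ ψ∈ → ψ∈) d

  LangPath⇒μ : ∀ {σ} → LangPath σ → ⟦ μ X (cfForm R X Ψ) ⟧ V σ
  LangPath⇒μ (_ , D , p) = sat-μ (LangPath⇒cfForm D p)

μ-mono-⊆L : ∀ {S} (R : S → S → Set) X {Ψ Ψ'} → Ψ' ⊆L Ψ →
            ∀ V σ → ⟦ μ X (cfForm R X Ψ') ⟧ V σ → ⟦ μ X (cfForm R X Ψ) ⟧ V σ
μ-mono-⊆L R X {Ψ} {Ψ'} Ψ'⊆Ψ V σ d with Unfolding.μ⇒LangPath R X V Ψ' d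
... | w , D , p = Unfolding.LangPath⇒μ R X V Ψ (w , Ψ'⊆Ψ w D , p)

Valid-strengthen-head : ∀ {S} {ξ : List (Side S)} {Γ Δ} {φ φ' : Form S} →
                        (∀ V σ → ⟦ φ ⟧ V σ → ⟦ φ' ⟧ V σ) →
                        Valid ξ Γ (φ ∷ Δ) → Valid ξ Γ (φ' ∷ Δ)
Valid-strengthen-head φ⇒φ' valid V ξ-holds σ Γ-holds with valid V ξ-holds σ Γ-holds
... | here d  = here (φ⇒φ' V σ d)
... | there d = there d

theorem6 : {S : Set} (R : S → S → Set) (X : Var) (Ψ Ψ' : CF)
    (ξ : List (Side S)) (Γ Δ : List (Form S)) →
    Ψ' ⊆L Ψ →
    Valid ξ Γ (μ X (cfForm R X Ψ') ∷ Δ) →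
    Valid ξ Γ (μ X (cfForm R X Ψ) ∷ Δ)
theorem6 R X Ψ Ψ' ξ Γ Δ Ψ'⊆Ψ = Valid-strengthen-head (μ-mono-⊆L R X Ψ'⊆Ψ)
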